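{- Let $n\ge 0$ and let $S\subseteq\mathbb{F}_2^n$ be a packed set in the deck $\mathbb{F}_2^n$. Then its complement $\mathbb{F}_2^n\setminus S$ is also a packed set in the deck $\mathbb{F}_2^n$.
   Context: An EvenQuads deck of size $2^n$ is the set $\mathbb{F}_2^n$; its elements are called cards. A quad is a $4$-element subset $\{a,b,c,d\}$ of the deck with $a+b+c+d=0$. The number of quads in a set of cards is the number of its $4$-element subsets that are quads. A set $S\subseteq \mathbb{F}_2^n$ is packed (in the deck $\mathbb{F}_2^n$) if the number of quads in $S$ is maximal among all subsets of $\mathbb{F}_2^n$ of cardinality $|S|$. -}

module Defs where

open import Data.Bool using (Bool; true; false; not; _xor_; _∧_)
open import Data.Nat using (ℕ; zero; suc; _+_; _≤_)
open import Data.List using (List; []; _∷_; _++_; map; length; filter)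
open import Data.Vec using (Vec; []; _∷_; zipWith)
open import Relation.Binary.PropositionalEquality using (_≡_)

Card : ℕ → Set
Card n = Vec Bool n

_⊕_ : ∀ {n} → Card n → Card n → Card n
_⊕_ = zipWith _xor_

𝟎 : ∀ {n} → Card n
𝟎 {zero} = []
𝟎 {suc n} = false ∷ 𝟎

isZero : ∀ {n} → Card n → Bool
isZero [] = true
isZero (true ∷ v) = false
isZero (false ∷ v) = isZero v

deck : (n : ℕ) → List (Card n)
deck zero = [] ∷ []
deck (suc n) = map (false ∷_) (deck n) ++ map (true ∷_) (deck n)

CardSet : ℕ → Set
CardSet n = Card n → Bool

complement : ∀ {n} → CardSet n → CardSet n
complement S x = not (S x)

elems : ∀ {n} → CardSet n → List (Card n)
elems {n} S = filter (λ x → Data.Bool._≟_ (S x) true) (deck n)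
  where import Data.Bool

card : ∀ {n} → CardSet n → ℕ
card S = length (elems S)

-- All k-element sub-multisets chosen from distinct positions of a list
-- (i.e. all k-element subsets when the list has no repetitions).
choose : ∀ {A : Set} → ℕ → List A → List (List A)
choose zero xs = [] ∷ []
choose (suc k) [] = []
choose (suc k) (x ∷ xs) = map (x ∷_) (choose k xs) ++ choose (suc k) xs

isQuad : ∀ {n} → List (Card n) → Bool
isQuad (a ∷ b ∷ c ∷ d ∷ []) = isZero (a ⊕ (b ⊕ (c ⊕ d)))
isQuad _ = false

quads : ∀ {n} → CardSet n → ℕ
quads S = length (filter (λ q → Data.Bool._≟_ (isQuad q) true) (choose 4 (elems S)))
  where import Data.Bool

Packed : ∀ {n} → CardSet n → Set
Packed {n} S = (T : CardSet n) → card T ≡ card S → quads T ≤ quads S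

-- Let F(S) be the number of ordered (a, b, c, d) ∈ S⁴ with a + b + c + d = 0, and k = |S|.
-- Counting ordered quads and correcting for coincidences (if two of a, b, c are equal, the
-- fourth card equals the third) gives 24·quads(S) + 3k² = F(S) + 2k, so among sets of a fixed
-- size, maximising the number of quads is the same as maximising F.
-- F is the diagonal of the symmetric quadrilinear form
-- Q(f₁, f₂, f₃, f₄) = Σ_{a+b+c+d=0} f₁(a) f₂(b) f₃(c) f₄(d), with Q(f, g, h, 1) = Σf·Σg·Σh.
-- Expanding F(𝔽₂ⁿ ∖ S) = Q(1 − 1_S, …) yields F(𝔽₂ⁿ ∖ S) − F(S) = m³ − k m² + k² m − k³
-- with m = 2ⁿ − k, which depends on k only; hence complementation preserves the order of F
-- among sets of size k.
module Submission where

open import Defs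
open import Algebra.Bundles using (CommutativeSemigroup)
import Algebra.Properties.CommutativeSemigroup as CommutativeSemigroupProperties
open import Data.Bool using (Bool; true; false; not; _xor_)
import Data.Bool as Bool
open import Data.Bool.Properties using (xor-assoc; xor-comm; xor-same; not-involutive)
open import Data.List using (List; []; _∷_; _++_; map; length; filter)
open import Data.List.Properties using (filter-accept; filter-reject; filter-all)
import Data.List.Relation.Unary.All as All
open import Data.List.Relation.Unary.All using (All; []; _∷_)
open import Data.List.Relation.Unary.AllPairs using ([]; _∷_)
open import Data.List.Relation.Unary.Unique.Propositional using (Unique)
open import Data.List.Relation.Unary.Unique.Propositional.Properties using (filter⁺; map⁺; ++⁺)
open import Data.List.Relation.Binary.Disjoint.Propositional using (Disjoint)
open import Data.List.Membership.Propositional.Properties using (∈-map⁻)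
open import Data.Nat using (ℕ; zero; suc; _+_; _*_; _≤_; _!)
open import Data.Nat.Properties
  using (+-comm; +-assoc; +-identityʳ; *-zeroʳ; *-distribˡ-+; *-comm; *-identityˡ; *-identityʳ; *-assoc;
         +-cancelˡ-≡; +-cancelʳ-≤; *-cancelˡ-≤; +-monoˡ-≤; *-monoʳ-≤; module ≤-Reasoning)
open import Data.Nat.Tactic.RingSolver using (solve-∀)
open import Data.Product using (_,_)
open import Data.Vec using ([]; _∷_)
open import Data.Vec.Properties using (zipWith-assoc; zipWith-comm; ≡-dec; ∷-injectiveʳ)
open import Function using (_∘_)
open import Level using (0ℓ)
open import Relation.Binary.Definitions using (DecidableEquality)
open import Relation.Binary.PropositionalEquality using (_≡_; _≢_; refl; sym; trans; cong; cong₂; module ≡-Reasoning)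
open import Relation.Binary.PropositionalEquality.Algebra using (isMagma)
open import Relation.Nullary using (Dec; does; ¬?; yes; no; contradiction)

-- Finite sums

∑ : {A : Set} → List A → (A → ℕ) → ℕ
∑ []       f = 0
∑ (x ∷ xs) f = f x + ∑ xs f

syntax ∑ xs (λ x → e) = ∑[ x ∈ xs ] e

private variable
  A B : Set

∑-cong : ∀ (xs : List A) {f g : A → ℕ} → (∀ x → f x ≡ g x) → ∑ xs f ≡ ∑ xs g
∑-cong []       f≗g = refl
∑-cong (x ∷ xs) f≗g = cong₂ _+_ (f≗g x) (∑-cong xs f≗g)

∑-congᴬ : ∀ {xs : List A} {f g : A → ℕ} → All (λ x → f x ≡ g x) xs → ∑ xs f ≡ ∑ xs g
∑-congᴬ []            = refl
∑-congᴬ (fx≡gx ∷ eqs) = cong₂ _+_ fx≡gx (∑-congᴬ eqs)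

∑-+ : ∀ (xs : List A) (f g : A → ℕ) → ∑[ x ∈ xs ] (f x + g x) ≡ ∑ xs f + ∑ xs g
∑-+ []       f g = refl
∑-+ (x ∷ xs) f g rewrite ∑-+ xs f g = +-+-comm (f x) (g x) (∑ xs f) (∑ xs g)
  where
  +-+-comm : ∀ a b c d → a + b + (c + d) ≡ a + c + (b + d)
  +-+-comm = solve-∀

∑-*ˡ : ∀ (xs : List A) (c : ℕ) (f : A → ℕ) → ∑[ x ∈ xs ] (c * f x) ≡ c * ∑ xs f
∑-*ˡ []       c f = sym (*-zeroʳ c)
∑-*ˡ (x ∷ xs) c f rewrite ∑-*ˡ xs c f = sym (*-distribˡ-+ c (f x) (∑ xs f))

∑-*ʳ : ∀ (xs : List A) (c : ℕ) (f : A → ℕ) → ∑[ x ∈ xs ] (f x * c) ≡ ∑ xs f * c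
∑-*ʳ xs c f = begin
  ∑[ x ∈ xs ] (f x * c)  ≡⟨ ∑-cong xs (λ x → *-comm (f x) c) ⟩
  ∑[ x ∈ xs ] (c * f x)  ≡⟨ ∑-*ˡ xs c f ⟩
  c * ∑ xs f             ≡⟨ *-comm c (∑ xs f) ⟩
  ∑ xs f * c             ∎
  where open ≡-Reasoning

∑-zero : (xs : List B) → ∑[ x ∈ xs ] 0 ≡ 0
∑-zero []       = refl
∑-zero (x ∷ xs) = ∑-zero xs

∑-++ : ∀ (xs ys : List A) (f : A → ℕ) → ∑ (xs ++ ys) f ≡ ∑ xs f + ∑ ys f
∑-++ []       ys f = refl
∑-++ (x ∷ xs) ys f rewrite ∑-++ xs ys f = sym (+-assoc (f x) (∑ xs f) (∑ ys f))

∑-map : (h : B → A) (xs : List B) (f : A → ℕ) → ∑ (map h xs) f ≡ ∑ xs (f ∘ h)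
∑-map h []       f = refl
∑-map h (x ∷ xs) f = cong (f (h x) +_) (∑-map h xs f)

∑-comm : (xs : List A) (ys : List B) (f : A → B → ℕ) →
         ∑[ x ∈ xs ] ∑[ y ∈ ys ] f x y ≡ ∑[ y ∈ ys ] ∑[ x ∈ xs ] f x y
∑-comm []       ys f = sym (∑-zero ys)
∑-comm (x ∷ xs) ys f = begin
  ∑ ys (f x) + ∑[ x′ ∈ xs ] ∑[ y ∈ ys ] f x′ y  ≡⟨ cong (∑ ys (f x) +_) (∑-comm xs ys f) ⟩
  ∑ ys (f x) + ∑[ y ∈ ys ] ∑[ x′ ∈ xs ] f x′ y  ≡⟨ ∑-+ ys (f x) _ ⟨
  ∑[ y ∈ ys ] (f x y + ∑[ x′ ∈ xs ] f x′ y)     ∎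
  where open ≡-Reasoning

∑-product : (xs : List A) (ys : List B) (f : A → ℕ) (g : B → ℕ) →
            ∑[ x ∈ xs ] ∑[ y ∈ ys ] (f x * g y) ≡ ∑ xs f * ∑ ys g
∑-product xs ys f g = begin
  ∑[ x ∈ xs ] ∑[ y ∈ ys ] (f x * g y)  ≡⟨ ∑-cong xs (λ x → ∑-*ˡ ys (f x) g) ⟩
  ∑[ x ∈ xs ] (f x * ∑ ys g)           ≡⟨ ∑-*ʳ xs (∑ ys g) f ⟩
  ∑ xs f * ∑ ys g                      ∎
  where open ≡-Reasoning

𝟙 : Bool → ℕ
𝟙 true  = 1
𝟙 false = 0

𝟙-idem : ∀ b → 𝟙 b * 𝟙 b ≡ 𝟙 b
𝟙-idem true  = refl
𝟙-idem false = refl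

∑-filter : ∀ {P : A → Set} (P? : ∀ x → Dec (P x)) (xs : List A) (f : A → ℕ) →
           ∑ (filter P? xs) f ≡ ∑[ x ∈ xs ] (𝟙 (does (P? x)) * f x)
∑-filter P? []       f = refl
∑-filter P? (x ∷ xs) f with does (P? x)
... | true  = cong₂ _+_ (sym (+-identityʳ (f x))) (∑-filter P? xs f)
... | false = ∑-filter P? xs f

length≡∑1 : (xs : List A) → length xs ≡ ∑[ x ∈ xs ] 1
length≡∑1 []       = refl
length≡∑1 (x ∷ xs) = cong suc (length≡∑1 xs)

-- Ordered and unordered selections

module OrderedSelections {A : Set} (_≟_ : DecidableEquality A) where

  remove : A → List A → List A
  remove a = filter (λ x → ¬? (x ≟ a))

  orderedSum : ℕ → List A → (List A → ℕ) → ℕ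
  orderedSum zero    xs g = g []
  orderedSum (suc k) xs g = ∑[ a ∈ xs ] orderedSum k (remove a xs) (g ∘ (a ∷_))

  Symmetric : (List A → ℕ) → Set
  Symmetric g = ∀ p a b t → g (p ++ a ∷ b ∷ t) ≡ g (p ++ b ∷ a ∷ t)

  Symmetric-∷ : ∀ {g} x → Symmetric g → Symmetric (g ∘ (x ∷_))
  Symmetric-∷ x sym-g p = sym-g (x ∷ p)

  ∑-remove : ∀ a xs (f : A → ℕ) → ∑ (remove a xs) f ≡ ∑[ x ∈ xs ] (𝟙 (not (does (x ≟ a))) * f x)
  ∑-remove a = ∑-filter (λ x → ¬? (x ≟ a))

  remove-head : ∀ {x xs} → All (x ≢_) xs → remove x (x ∷ xs) ≡ xs
  remove-head {x} x∉xs =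
    trans (filter-reject (λ y → ¬? (y ≟ x)) (λ x≢x → x≢x refl))
          (filter-all (λ y → ¬? (y ≟ x)) (All.map (_∘ sym) x∉xs))

  remove-∷ : ∀ {a x} xs → x ≢ a → remove a (x ∷ xs) ≡ x ∷ remove a xs
  remove-∷ {a} xs = filter-accept (λ y → ¬? (y ≟ a))

  remove-unique : ∀ a {xs} → Unique xs → Unique (remove a xs)
  remove-unique a = filter⁺ (λ y → ¬? (y ≟ a))

  ∑-choose-∷ : ∀ k x xs (g : List A → ℕ) →
               ∑ (choose (suc k) (x ∷ xs)) g ≡ ∑ (choose k xs) (g ∘ (x ∷_)) + ∑ (choose (suc k) xs) g
  ∑-choose-∷ k x xs g = trans (∑-++ (map (x ∷_) (choose k xs)) _ g) (cong (_+ _) (∑-map (x ∷_) (choose k xs) g))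

  ∑-choose-1 : ∀ xs (g : List A → ℕ) → ∑ (choose 1 xs) g ≡ ∑[ a ∈ xs ] g (a ∷ [])
  ∑-choose-1 []       g = refl
  ∑-choose-1 (x ∷ xs) g = cong (g (x ∷ []) +_) (∑-choose-1 xs g)

  -- Double counting of (k+1)-subsets with a distinguished element.
  suc*∑-choose : ∀ k {xs} → Unique xs → ∀ {g} → Symmetric g →
                 suc k * ∑ (choose (suc k) xs) g ≡ ∑[ a ∈ xs ] ∑ (choose k (remove a xs)) (g ∘ (a ∷_))
  suc*∑-choose zero    {xs} _ {g} _ = begin
    1 * ∑ (choose 1 xs) g          ≡⟨ *-identityˡ _ ⟩
    ∑ (choose 1 xs) g              ≡⟨ ∑-choose-1 xs g ⟩
    ∑[ a ∈ xs ] g (a ∷ [])         ≡⟨ ∑-cong xs (λ a → +-identityʳ (g (a ∷ []))) ⟨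
    ∑[ a ∈ xs ] (g (a ∷ []) + 0)   ∎
    where open ≡-Reasoning
  suc*∑-choose (suc j) {[]} _ _ = *-zeroʳ (suc (suc j))
  suc*∑-choose (suc j) {x ∷ xs} (x∉xs ∷ xs-unique) {g} sym-g = begin
    suc (suc j) * ∑ (choose (suc (suc j)) (x ∷ xs)) g
      ≡⟨ cong (suc (suc j) *_) (∑-choose-∷ (suc j) x xs g) ⟩
    suc (suc j) * (A₀ + B₀)
      ≡⟨ distrib (suc j) A₀ B₀ ⟩
    A₀ + (suc j * A₀ + suc (suc j) * B₀)
      ≡⟨ cong (A₀ +_) (cong₂ _+_ (suc*∑-choose j xs-unique (Symmetric-∷ {g} x sym-g))
                                 (suc*∑-choose (suc j) xs-unique sym-g)) ⟩
    A₀ + (∑[ a ∈ xs ] ∑ (choose j (remove a xs)) (g ∘ (x ∷_) ∘ (a ∷_))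
          + ∑[ a ∈ xs ] ∑ (choose (suc j) (remove a xs)) (g ∘ (a ∷_)))
      ≡⟨ cong (λ z → A₀ + (z + _)) (∑-cong xs (λ a → ∑-cong (choose j (remove a xs)) (sym-g [] x a))) ⟩
    A₀ + (∑[ a ∈ xs ] ∑ (choose j (remove a xs)) (g ∘ (a ∷_) ∘ (x ∷_))
          + ∑[ a ∈ xs ] ∑ (choose (suc j) (remove a xs)) (g ∘ (a ∷_)))
      ≡⟨ cong (A₀ +_) (∑-+ xs _ _) ⟨
    A₀ + ∑[ a ∈ xs ] (∑ (choose j (remove a xs)) (g ∘ (a ∷_) ∘ (x ∷_))
                      + ∑ (choose (suc j) (remove a xs)) (g ∘ (a ∷_)))
      ≡⟨ cong (A₀ +_) (∑-cong xs (λ a → ∑-choose-∷ j x (remove a xs) (g ∘ (a ∷_)))) ⟨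
    A₀ + ∑[ a ∈ xs ] ∑ (choose (suc j) (x ∷ remove a xs)) (g ∘ (a ∷_))
      ≡⟨ cong₂ _+_ (cong (λ ys → ∑ (choose (suc j) ys) (g ∘ (x ∷_))) (remove-head x∉xs))
                   (∑-congᴬ (All.map (λ x≢a → cong (λ ys → ∑ (choose (suc j) ys) _) (remove-∷ xs x≢a)) x∉xs)) ⟨
    ∑[ a ∈ x ∷ xs ] ∑ (choose (suc j) (remove a (x ∷ xs))) (g ∘ (a ∷_))
      ∎
    where
    open ≡-Reasoning
    A₀ B₀ : ℕ
    A₀ = ∑ (choose (suc j) xs) (g ∘ (x ∷_))
    B₀ = ∑ (choose (suc (suc j)) xs) g
    distrib : ∀ m a b → suc m * (a + b) ≡ a + (m * a + suc m * b)
    distrib = solve-∀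

  !*∑-choose≡orderedSum : ∀ k {xs} → Unique xs → ∀ {g} → Symmetric g →
                          k ! * ∑ (choose k xs) g ≡ orderedSum k xs g
  !*∑-choose≡orderedSum zero    _ {g} _ = trans (+-identityʳ (g [] + 0)) (+-identityʳ (g []))
  !*∑-choose≡orderedSum (suc k) {xs} xs-unique {g} sym-g = begin
    suc k * k ! * C                                          ≡⟨ *-assoc (suc k) (k !) C ⟩
    suc k * (k ! * C)                                        ≡⟨ x*[y*z]≡y*[x*z] (suc k) (k !) C ⟩
    k ! * (suc k * C)                                        ≡⟨ cong (k ! *_) (suc*∑-choose k xs-unique sym-g) ⟩
    k ! * ∑[ a ∈ xs ] ∑ (choose k (remove a xs)) (g ∘ (a ∷_))  ≡⟨ ∑-*ˡ xs (k !) _ ⟨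
    ∑[ a ∈ xs ] (k ! * ∑ (choose k (remove a xs)) (g ∘ (a ∷_)))
      ≡⟨ ∑-cong xs (λ a → !*∑-choose≡orderedSum k (remove-unique a xs-unique) (Symmetric-∷ {g} a sym-g)) ⟩
    orderedSum (suc k) xs g                                  ∎
    where
    open ≡-Reasoning
    C : ℕ
    C = ∑ (choose (suc k) xs) g
    x*[y*z]≡y*[x*z] : ∀ x y z → x * (y * z) ≡ y * (x * z)
    x*[y*z]≡y*[x*z] = solve-∀

-- The group 𝔽₂ⁿ and its sums

infix 4 _≟_
_≟_ : ∀ {n} → DecidableEquality (Card n)
_≟_ = ≡-dec Bool._≟_

open module Selections {n} = OrderedSelections (_≟_ {n})
  using (remove; orderedSum; Symmetric; ∑-remove; !*∑-choose≡orderedSum)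

[_≡_] [_≢_] : ∀ {n} → Card n → Card n → ℕ
[ x ≡ y ] = 𝟙 (does (x ≟ y))
[ x ≢ y ] = 𝟙 (not (does (x ≟ y)))

⊕-assoc : ∀ {n} (x y z : Card n) → (x ⊕ y) ⊕ z ≡ x ⊕ (y ⊕ z)
⊕-assoc = zipWith-assoc xor-assoc

⊕-comm : ∀ {n} (x y : Card n) → x ⊕ y ≡ y ⊕ x
⊕-comm = zipWith-comm xor-comm

⊕-cancelˡ : ∀ {n} (x y : Card n) → x ⊕ (x ⊕ y) ≡ y
⊕-cancelˡ []       []       = refl
⊕-cancelˡ (b ∷ x) (c ∷ y) = cong₂ _∷_ (trans (sym (xor-assoc b b c)) (cong (_xor c) (xor-same b))) (⊕-cancelˡ x y)

⊕-commutativeSemigroup : ℕ → CommutativeSemigroup 0ℓ 0ℓ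
⊕-commutativeSemigroup n = record
  { isCommutativeSemigroup = record
    { isSemigroup = record { isMagma = isMagma (_⊕_ {n}) ; assoc = ⊕-assoc }
    ; comm        = ⊕-comm
    }
  }

module ⊕ {n} = CommutativeSemigroupProperties (⊕-commutativeSemigroup n)

isZero-⊕ : ∀ {n} (x y : Card n) → isZero (x ⊕ y) ≡ does (x ≟ y)
isZero-⊕ []           []          = refl
isZero-⊕ (false ∷ x) (false ∷ y) = isZero-⊕ x y
isZero-⊕ (false ∷ x) (true ∷ y)  = refl
isZero-⊕ (true ∷ x)  (false ∷ y) = refl
isZero-⊕ (true ∷ x)  (true ∷ y)  = isZero-⊕ x y

does-≟-⊕ : ∀ {n} {x y z w : Card n} → x ⊕ y ≡ z ⊕ w → does (x ≟ y) ≡ does (z ≟ w)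
does-≟-⊕ {x = x} {y} {z} {w} eq = trans (sym (isZero-⊕ x y)) (trans (cong isZero eq) (isZero-⊕ z w))

⊕-cancel-twice : ∀ {n} (a b c : Card n) → a ⊕ (b ⊕ (a ⊕ (b ⊕ c))) ≡ c
⊕-cancel-twice a b c = begin
  a ⊕ (b ⊕ (a ⊕ (b ⊕ c)))   ≡⟨ cong (a ⊕_) (⊕.x∙yz≈y∙xz b a (b ⊕ c)) ⟩
  a ⊕ (a ⊕ (b ⊕ (b ⊕ c)))   ≡⟨ ⊕-cancelˡ a _ ⟩
  b ⊕ (b ⊕ c)               ≡⟨ ⊕-cancelˡ b c ⟩
  c                         ∎
  where open ≡-Reasoning

isQuad≡does : ∀ {n} (a b c d : Card n) → isQuad (a ∷ b ∷ c ∷ d ∷ []) ≡ does (d ≟ a ⊕ (b ⊕ c))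
isQuad≡does a b c d = trans (cong isZero sum≡d+e) (isZero-⊕ d (a ⊕ (b ⊕ c)))
  where
  open ≡-Reasoning
  sum≡d+e : a ⊕ (b ⊕ (c ⊕ d)) ≡ d ⊕ (a ⊕ (b ⊕ c))
  sum≡d+e = begin
    a ⊕ (b ⊕ (c ⊕ d))   ≡⟨ cong (λ x → a ⊕ (b ⊕ x)) (⊕-comm c d) ⟩
    a ⊕ (b ⊕ (d ⊕ c))   ≡⟨ cong (a ⊕_) (⊕.x∙yz≈y∙xz b d c) ⟩
    a ⊕ (d ⊕ (b ⊕ c))   ≡⟨ ⊕.x∙yz≈y∙xz a d (b ⊕ c) ⟩
    d ⊕ (a ⊕ (b ⊕ c))   ∎

fourth≢ : ∀ {n} (a b c : Card n) → let d = a ⊕ (b ⊕ c) in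
          [ d ≢ a ] * ([ d ≢ b ] * [ d ≢ c ]) ≡ [ c ≢ b ] * ([ c ≢ a ] * [ b ≢ a ])
fourth≢ a b c = cong₂ _*_ (≢-cong d≡a⊕cb) (cong₂ _*_ (≢-cong d≡b⊕ca) (≢-cong d≡c⊕ba))
  where
  open ≡-Reasoning
  ≢-cong : ∀ {x y z w} → x ⊕ y ≡ z ⊕ w → [ x ≢ y ] ≡ [ z ≢ w ]
  ≢-cong eq = cong (𝟙 ∘ not) (does-≟-⊕ eq)
  d≡a⊕cb : (a ⊕ (b ⊕ c)) ⊕ a ≡ c ⊕ b
  d≡a⊕cb = begin
    (a ⊕ (b ⊕ c)) ⊕ a   ≡⟨ ⊕-comm (a ⊕ (b ⊕ c)) a ⟩
    a ⊕ (a ⊕ (b ⊕ c))   ≡⟨ ⊕-cancelˡ a (b ⊕ c) ⟩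
    b ⊕ c               ≡⟨ ⊕-comm b c ⟩
    c ⊕ b               ∎
  d≡b⊕ca : (a ⊕ (b ⊕ c)) ⊕ b ≡ c ⊕ a
  d≡b⊕ca = begin
    (a ⊕ (b ⊕ c)) ⊕ b   ≡⟨ ⊕-comm (a ⊕ (b ⊕ c)) b ⟩
    b ⊕ (a ⊕ (b ⊕ c))   ≡⟨ cong (b ⊕_) (⊕.x∙yz≈y∙xz a b c) ⟩
    b ⊕ (b ⊕ (a ⊕ c))   ≡⟨ ⊕-cancelˡ b (a ⊕ c) ⟩
    a ⊕ c               ≡⟨ ⊕-comm a c ⟩
    c ⊕ a               ∎
  d≡c⊕ba : (a ⊕ (b ⊕ c)) ⊕ c ≡ b ⊕ a
  d≡c⊕ba = begin
    (a ⊕ (b ⊕ c)) ⊕ c   ≡⟨ ⊕-comm (a ⊕ (b ⊕ c)) c ⟩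
    c ⊕ (a ⊕ (b ⊕ c))   ≡⟨ cong (c ⊕_) (⊕.x∙yz≈z∙xy a b c) ⟩
    c ⊕ (c ⊕ (a ⊕ b))   ≡⟨ ⊕-cancelˡ c (a ⊕ b) ⟩
    a ⊕ b               ≡⟨ ⊕-comm a b ⟩
    b ⊕ a               ∎

∑-deck-suc : ∀ {n} (f : Card (suc n) → ℕ) →
             ∑ (deck (suc n)) f ≡ ∑[ x ∈ deck n ] f (false ∷ x) + ∑[ x ∈ deck n ] f (true ∷ x)
∑-deck-suc {n} f = trans (∑-++ (map (false ∷_) (deck n)) _ f)
                         (cong₂ _+_ (∑-map (false ∷_) (deck n) f) (∑-map (true ∷_) (deck n) f))

∑-deck-translate : ∀ {n} (v : Card n) (f : Card n → ℕ) → ∑[ x ∈ deck n ] f (v ⊕ x) ≡ ∑ (deck n) f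
∑-deck-translate []      f = refl
∑-deck-translate {suc n} (b ∷ v) f = begin
  ∑[ x ∈ deck (suc n) ] f ((b ∷ v) ⊕ x)
    ≡⟨ ∑-deck-suc (λ x → f ((b ∷ v) ⊕ x)) ⟩
  ∑[ x ∈ deck n ] f ((b xor false) ∷ v ⊕ x) + ∑[ x ∈ deck n ] f ((b xor true) ∷ v ⊕ x)
    ≡⟨ cong₂ _+_ (∑-deck-translate v (f ∘ ((b xor false) ∷_))) (∑-deck-translate v (f ∘ ((b xor true) ∷_))) ⟩
  ∑[ x ∈ deck n ] f ((b xor false) ∷ x) + ∑[ x ∈ deck n ] f ((b xor true) ∷ x)
    ≡⟨ halves b ⟩
  ∑[ x ∈ deck n ] f (false ∷ x) + ∑[ x ∈ deck n ] f (true ∷ x)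
    ≡⟨ ∑-deck-suc f ⟨
  ∑ (deck (suc n)) f
    ∎
  where
  open ≡-Reasoning
  halves : ∀ b → ∑[ x ∈ deck n ] f ((b xor false) ∷ x) + ∑[ x ∈ deck n ] f ((b xor true) ∷ x)
               ≡ ∑[ x ∈ deck n ] f (false ∷ x) + ∑[ x ∈ deck n ] f (true ∷ x)
  halves false = refl
  halves true  = +-comm (∑[ x ∈ deck n ] f (true ∷ x)) (∑[ x ∈ deck n ] f (false ∷ x))

∑-deck-δ : ∀ {n} (a : Card n) (f : Card n → ℕ) → ∑[ x ∈ deck n ] ([ x ≡ a ] * f x) ≡ f a
∑-deck-δ []      f = trans (+-identityʳ (f [] + 0)) (+-identityʳ (f []))
∑-deck-δ {suc n} (b ∷ a) f = trans (∑-deck-suc (λ x → [ x ≡ b ∷ a ] * f x)) (halves b)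
  where
  halves : ∀ b → ∑[ x ∈ deck n ] ([ false ∷ x ≡ b ∷ a ] * f (false ∷ x))
               + ∑[ x ∈ deck n ] ([ true ∷ x ≡ b ∷ a ] * f (true ∷ x)) ≡ f (b ∷ a)
  halves false = trans (cong₂ _+_ (∑-deck-δ a (f ∘ (false ∷_))) (∑-zero (deck n))) (+-identityʳ _)
  halves true  = trans (cong (_+ ∑[ x ∈ deck n ] ([ x ≡ a ] * f (true ∷ x))) (∑-zero (deck n)))
                       (∑-deck-δ a (f ∘ (true ∷_)))

deck-unique : ∀ n → Unique (deck n)
deck-unique zero    = [] ∷ []
deck-unique (suc n) = ++⁺ (map⁺ ∷-injectiveʳ (deck-unique n)) (map⁺ ∷-injectiveʳ (deck-unique n)) disjoint
  where
  disjoint : Disjoint (map (false ∷_) (deck n)) (map (true ∷_) (deck n))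
  disjoint (v∈falses , v∈trues) with ∈-map⁻ (false ∷_) v∈falses | ∈-map⁻ (true ∷_) v∈trues
  ... | _ , _ , refl | _ , _ , ()

-- Sets of cards

χ : ∀ {n} → CardSet n → Card n → ℕ
χ S x = 𝟙 (S x)

does-≟-true : ∀ b → does (b Bool.≟ true) ≡ b
does-≟-true true  = refl
does-≟-true false = refl

∑-elems : ∀ {n} (S : CardSet n) (f : Card n → ℕ) → ∑ (elems S) f ≡ ∑[ x ∈ deck n ] (χ S x * f x)
∑-elems {n} S f = trans (∑-filter (λ x → S x Bool.≟ true) (deck n) f)
                        (∑-cong (deck n) (λ x → cong (λ b → 𝟙 b * f x) (does-≟-true (S x))))

card≡∑χ : ∀ {n} (S : CardSet n) → card S ≡ ∑ (deck n) (χ S)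
card≡∑χ {n} S = trans (length≡∑1 (elems S))
                      (trans (∑-elems S (λ _ → 1)) (∑-cong (deck n) (λ x → *-identityʳ (χ S x))))

χ+χᶜ≡1 : ∀ {n} (S : CardSet n) x → χ S x + χ (complement S) x ≡ 1
χ+χᶜ≡1 S x with S x
... | true  = refl
... | false = refl

card+card-complement : ∀ {n} (S : CardSet n) → card S + card (complement S) ≡ length (deck n)
card+card-complement {n} S = begin
  card S + card (complement S)                        ≡⟨ cong₂ _+_ (card≡∑χ S) (card≡∑χ (complement S)) ⟩
  ∑ (deck n) (χ S) + ∑ (deck n) (χ (complement S))    ≡⟨ ∑-+ (deck n) _ _ ⟨
  ∑[ x ∈ deck n ] (χ S x + χ (complement S) x)        ≡⟨ ∑-cong (deck n) (χ+χᶜ≡1 S) ⟩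
  ∑[ x ∈ deck n ] 1                                   ≡⟨ length≡∑1 (deck n) ⟨
  length (deck n)                                     ∎
  where open ≡-Reasoning

card-complement-cong : ∀ {n} (S T : CardSet n) → card S ≡ card T → card (complement S) ≡ card (complement T)
card-complement-cong {n} S T |S|≡|T| = +-cancelˡ-≡ (card S) _ _ (begin
  card S + card (complement S)   ≡⟨ card+card-complement S ⟩
  length (deck n)                ≡⟨ card+card-complement T ⟨
  card T + card (complement T)   ≡⟨ cong (_+ card (complement T)) |S|≡|T| ⟨
  card S + card (complement T)   ∎)
  where open ≡-Reasoning

card-complement-flip : ∀ {n} (S T : CardSet n) → card S ≡ card (complement T) → card (complement S) ≡ card T
card-complement-flip {n} S T |S|≡|Tᶜ| = +-cancelˡ-≡ (card S) _ _ (begin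
  card S + card (complement S)   ≡⟨ card+card-complement S ⟩
  length (deck n)                ≡⟨ card+card-complement T ⟨
  card T + card (complement T)   ≡⟨ +-comm (card T) _ ⟩
  card (complement T) + card T   ≡⟨ cong (_+ card T) |S|≡|Tᶜ| ⟨
  card S + card T                ∎)
  where open ≡-Reasoning

-- Zero-sum quadruples

module _ {n : ℕ} where

  ∑³ : (Card n → Card n → Card n → ℕ) → ℕ
  ∑³ f = ∑[ a ∈ deck n ] ∑[ b ∈ deck n ] ∑[ c ∈ deck n ] f a b c

  ∑³-cong : ∀ {f g : Card n → Card n → Card n → ℕ} → (∀ a b c → f a b c ≡ g a b c) → ∑³ f ≡ ∑³ g
  ∑³-cong f≗g = ∑-cong (deck n) (λ a → ∑-cong (deck n) (λ b → ∑-cong (deck n) (f≗g a b)))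

  ∑³-+ : ∀ (f g : Card n → Card n → Card n → ℕ) → ∑³ (λ a b c → f a b c + g a b c) ≡ ∑³ f + ∑³ g
  ∑³-+ f g = trans (∑-cong (deck n) (λ a → trans (∑-cong (deck n) (λ b → ∑-+ (deck n) (f a b) (g a b)))
                                                (∑-+ (deck n) _ _)))
                   (∑-+ (deck n) _ _)

  ∑³-*ˡ : ∀ m (f : Card n → Card n → Card n → ℕ) → ∑³ (λ a b c → m * f a b c) ≡ m * ∑³ f
  ∑³-*ˡ m f = trans (∑-cong (deck n) (λ a → trans (∑-cong (deck n) (λ b → ∑-*ˡ (deck n) m (f a b)))
                                                 (∑-*ˡ (deck n) m _)))
                    (∑-*ˡ (deck n) m _)

  -- d = a ⊕ (b ⊕ c) is the card with a + b + c + d = 0.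
  quadTerm : (f₁ f₂ f₃ f₄ : Card n → ℕ) → Card n → Card n → Card n → ℕ
  quadTerm f₁ f₂ f₃ f₄ a b c = f₁ a * (f₂ b * (f₃ c * f₄ (a ⊕ (b ⊕ c))))

  quadSum : (f₁ f₂ f₃ f₄ : Card n → ℕ) → ℕ
  quadSum f₁ f₂ f₃ f₄ = ∑³ (quadTerm f₁ f₂ f₃ f₄)

  ∑³-rotate : ∀ (f : Card n → Card n → Card n → ℕ) →
              ∑³ f ≡ ∑[ b ∈ deck n ] ∑[ c ∈ deck n ] ∑[ a ∈ deck n ] f a b c
  ∑³-rotate f = trans (∑-comm (deck n) (deck n) (λ a b → ∑ (deck n) (f a b)))
                      (∑-cong (deck n) (λ b → ∑-comm (deck n) (deck n) (λ a c → f a b c)))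

  quadSum-swap₃₄ : ∀ (f₁ f₂ f₃ f₄ : Card n → ℕ) → quadSum f₁ f₂ f₃ f₄ ≡ quadSum f₁ f₂ f₄ f₃
  quadSum-swap₃₄ f₁ f₂ f₃ f₄ = ∑-cong (deck n) (λ a → ∑-cong (deck n) (λ b → begin
    ∑[ c ∈ deck n ] quadTerm f₁ f₂ f₃ f₄ a b c
      ≡⟨ ∑-deck-translate (a ⊕ b) (quadTerm f₁ f₂ f₃ f₄ a b) ⟨
    ∑[ c ∈ deck n ] quadTerm f₁ f₂ f₃ f₄ a b ((a ⊕ b) ⊕ c)
      ≡⟨ ∑-cong (deck n) (λ c → cong (quadTerm f₁ f₂ f₃ f₄ a b) (⊕-assoc a b c)) ⟩
    ∑[ c ∈ deck n ] (f₁ a * (f₂ b * (f₃ (a ⊕ (b ⊕ c)) * f₄ (a ⊕ (b ⊕ (a ⊕ (b ⊕ c)))))))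
      ≡⟨ ∑-cong (deck n) (λ c → cong (λ d → f₁ a * (f₂ b * d))
           (trans (cong (f₃ (a ⊕ (b ⊕ c)) *_) (cong f₄ (⊕-cancel-twice a b c))) (*-comm _ (f₄ c)))) ⟩
    ∑[ c ∈ deck n ] quadTerm f₁ f₂ f₄ f₃ a b c
      ∎))
    where open ≡-Reasoning

  quadSum-swap₂₃ : ∀ (f₁ f₂ f₃ f₄ : Card n → ℕ) → quadSum f₁ f₂ f₃ f₄ ≡ quadSum f₁ f₃ f₂ f₄
  quadSum-swap₂₃ f₁ f₂ f₃ f₄ = ∑-cong (deck n) (λ a →
    trans (∑-comm (deck n) (deck n) (quadTerm f₁ f₂ f₃ f₄ a))
          (∑-cong (deck n) (λ c → ∑-cong (deck n) (λ b → swap a b c))))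
    where
    swap : ∀ a b c → quadTerm f₁ f₂ f₃ f₄ a b c ≡ quadTerm f₁ f₃ f₂ f₄ a c b
    swap a b c = cong (f₁ a *_) (trans (x*[y*z]≡y*[x*z] (f₂ b) (f₃ c) _)
                                       (cong (λ d → f₃ c * (f₂ b * f₄ (a ⊕ d))) (⊕-comm b c)))
      where
      x*[y*z]≡y*[x*z] : ∀ x y z → x * (y * z) ≡ y * (x * z)
      x*[y*z]≡y*[x*z] = solve-∀

  quadSum-swap₁₄ : ∀ (f₁ f₂ f₃ f₄ : Card n → ℕ) → quadSum f₁ f₂ f₃ f₄ ≡ quadSum f₄ f₂ f₃ f₁
  quadSum-swap₁₄ f₁ f₂ f₃ f₄ = begin
    quadSum f₁ f₂ f₃ f₄
      ≡⟨ ∑³-rotate (quadTerm f₁ f₂ f₃ f₄) ⟩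
    ∑[ b ∈ deck n ] ∑[ c ∈ deck n ] ∑[ a ∈ deck n ] quadTerm f₁ f₂ f₃ f₄ a b c
      ≡⟨ ∑-cong (deck n) (λ b → ∑-cong (deck n) (λ c →
           ∑-deck-translate (b ⊕ c) (λ a → quadTerm f₁ f₂ f₃ f₄ a b c))) ⟨
    ∑[ b ∈ deck n ] ∑[ c ∈ deck n ] ∑[ a ∈ deck n ] quadTerm f₁ f₂ f₃ f₄ ((b ⊕ c) ⊕ a) b c
      ≡⟨ ∑-cong (deck n) (λ b → ∑-cong (deck n) (λ c → ∑-cong (deck n) (λ a → swap a b c))) ⟩
    ∑[ b ∈ deck n ] ∑[ c ∈ deck n ] ∑[ a ∈ deck n ] quadTerm f₄ f₂ f₃ f₁ a b c
      ≡⟨ ∑³-rotate (quadTerm f₄ f₂ f₃ f₁) ⟨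
    quadSum f₄ f₂ f₃ f₁
      ∎
    where
    open ≡-Reasoning
    rearrange : ∀ x y z w → x * (y * (z * w)) ≡ w * (y * (z * x))
    rearrange = solve-∀
    swap : ∀ a b c → quadTerm f₁ f₂ f₃ f₄ ((b ⊕ c) ⊕ a) b c ≡ quadTerm f₄ f₂ f₃ f₁ a b c
    swap a b c = trans (cong₂ (λ x y → f₁ x * (f₂ b * (f₃ c * f₄ y))) (⊕-comm (b ⊕ c) a) recover-a)
                       (rearrange (f₁ (a ⊕ (b ⊕ c))) (f₂ b) (f₃ c) (f₄ a))
      where
      recover-a : ((b ⊕ c) ⊕ a) ⊕ (b ⊕ c) ≡ a
      recover-a = trans (⊕-comm ((b ⊕ c) ⊕ a) (b ⊕ c)) (⊕-cancelˡ (b ⊕ c) a)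

  quadSum-+₄ : ∀ (f₁ f₂ f₃ : Card n → ℕ) {f g h : Card n → ℕ} → (∀ x → h x ≡ f x + g x) →
               quadSum f₁ f₂ f₃ h ≡ quadSum f₁ f₂ f₃ f + quadSum f₁ f₂ f₃ g
  quadSum-+₄ f₁ f₂ f₃ {f} {g} {h} h≗f+g =
    trans (∑³-cong distrib) (∑³-+ (quadTerm f₁ f₂ f₃ f) (quadTerm f₁ f₂ f₃ g))
    where
    *-distrib³ : ∀ x y z u v → x * (y * (z * (u + v))) ≡ x * (y * (z * u)) + x * (y * (z * v))
    *-distrib³ = solve-∀
    distrib : ∀ a b c → quadTerm f₁ f₂ f₃ h a b c ≡ quadTerm f₁ f₂ f₃ f a b c + quadTerm f₁ f₂ f₃ g a b c
    distrib a b c = trans (cong (λ t → f₁ a * (f₂ b * (f₃ c * t))) (h≗f+g (a ⊕ (b ⊕ c))))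
                          (*-distrib³ (f₁ a) (f₂ b) (f₃ c) (f (a ⊕ (b ⊕ c))) (g (a ⊕ (b ⊕ c))))

  quadSum-1₄ : ∀ (f₁ f₂ f₃ : Card n → ℕ) →
               quadSum f₁ f₂ f₃ (λ _ → 1) ≡ ∑ (deck n) f₁ * (∑ (deck n) f₂ * ∑ (deck n) f₃)
  quadSum-1₄ f₁ f₂ f₃ = begin
    ∑[ a ∈ deck n ] ∑[ b ∈ deck n ] ∑[ c ∈ deck n ] (f₁ a * (f₂ b * (f₃ c * 1)))
      ≡⟨ ∑³-cong (λ a b c → cong (λ t → f₁ a * (f₂ b * t)) (*-identityʳ (f₃ c))) ⟩
    ∑[ a ∈ deck n ] ∑[ b ∈ deck n ] ∑[ c ∈ deck n ] (f₁ a * (f₂ b * f₃ c))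
      ≡⟨ ∑-cong (deck n) (λ a → trans (∑-cong (deck n) (λ b → ∑-*ˡ (deck n) (f₁ a) _))
                                      (∑-*ˡ (deck n) (f₁ a) _)) ⟩
    ∑[ a ∈ deck n ] (f₁ a * ∑[ b ∈ deck n ] ∑[ c ∈ deck n ] (f₂ b * f₃ c))
      ≡⟨ ∑-*ʳ (deck n) _ f₁ ⟩
    ∑ (deck n) f₁ * ∑[ b ∈ deck n ] ∑[ c ∈ deck n ] (f₂ b * f₃ c)
      ≡⟨ cong (∑ (deck n) f₁ *_) (∑-product (deck n) (deck n) f₂ f₃) ⟩
    ∑ (deck n) f₁ * (∑ (deck n) f₂ * ∑ (deck n) f₃)
      ∎
    where open ≡-Reasoning

zeroSumQuadruples : ∀ {n} → CardSet n → ℕ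
zeroSumQuadruples S = quadSum (χ S) (χ S) (χ S) (χ S)

-- The fourth card a ⊕ (b ⊕ c) is automatically distinct from a, b, c once these are pairwise distinct.
distinctZeroSumQuadruples : ∀ {n} → CardSet n → ℕ
distinctZeroSumQuadruples S = ∑³ λ a b c → [ b ≢ a ] * ([ c ≢ a ] * [ c ≢ b ]) * quadTerm (χ S) (χ S) (χ S) (χ S) a b c

zeroSumQuadruples-cong : ∀ {n} {S T : CardSet n} → (∀ x → S x ≡ T x) → zeroSumQuadruples S ≡ zeroSumQuadruples T
zeroSumQuadruples-cong {S = S} {T} S≗T =
  ∑³-cong (λ a b c → cong₂ _*_ (χ≗ a) (cong₂ _*_ (χ≗ b) (cong₂ _*_ (χ≗ c) (χ≗ _))))
  where
  χ≗ : ∀ x → χ S x ≡ χ T x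
  χ≗ x = cong 𝟙 (S≗T x)

-- Quads and zero-sum quadruples

quads≡∑choose : ∀ {n} (S : CardSet n) → quads S ≡ ∑ (choose 4 (elems S)) (𝟙 ∘ isQuad)
quads≡∑choose S = begin
  length (filter (λ q → isQuad q Bool.≟ true) (choose 4 (elems S)))
    ≡⟨ length≡∑1 (filter (λ q → isQuad q Bool.≟ true) (choose 4 (elems S))) ⟩
  ∑ (filter (λ q → isQuad q Bool.≟ true) (choose 4 (elems S))) (λ _ → 1)
    ≡⟨ ∑-filter (λ q → isQuad q Bool.≟ true) (choose 4 (elems S)) (λ _ → 1) ⟩
  ∑[ q ∈ choose 4 (elems S) ] (𝟙 (does (isQuad q Bool.≟ true)) * 1)
    ≡⟨ ∑-cong (choose 4 (elems S)) (λ q → trans (*-identityʳ _) (cong 𝟙 (does-≟-true (isQuad q)))) ⟩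
  ∑ (choose 4 (elems S)) (𝟙 ∘ isQuad)                                  ∎
  where open ≡-Reasoning

-- Lists not of length 4 are never quads, so only the first three clauses have content.
isQuad-symmetric : ∀ {n} → Symmetric {n} (𝟙 ∘ isQuad)
isQuad-symmetric []                       a b (c ∷ d ∷ [])    = cong (𝟙 ∘ isZero) (⊕.x∙yz≈y∙xz a b (c ⊕ d))
isQuad-symmetric (x ∷ [])                 a b (d ∷ [])        = cong (𝟙 ∘ isZero ∘ (x ⊕_)) (⊕.x∙yz≈y∙xz a b d)
isQuad-symmetric (x ∷ y ∷ [])             a b []              = cong (𝟙 ∘ isZero ∘ (x ⊕_) ∘ (y ⊕_)) (⊕-comm a b)
isQuad-symmetric []                       a b []              = refl
isQuad-symmetric []                       a b (_ ∷ [])        = refl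
isQuad-symmetric []                       a b (_ ∷ _ ∷ _ ∷ _) = refl
isQuad-symmetric (_ ∷ [])                 a b []              = refl
isQuad-symmetric (_ ∷ [])                 a b (_ ∷ _ ∷ _)     = refl
isQuad-symmetric (_ ∷ _ ∷ [])             a b (_ ∷ _)         = refl
isQuad-symmetric (_ ∷ _ ∷ _ ∷ [])         a b t               = refl
isQuad-symmetric (_ ∷ _ ∷ _ ∷ _ ∷ [])     a b t               = refl
isQuad-symmetric (_ ∷ _ ∷ _ ∷ _ ∷ _ ∷ _) a b t               = refl

24*quads≡orderedSum : ∀ {n} (S : CardSet n) → 24 * quads S ≡ orderedSum 4 (elems S) (𝟙 ∘ isQuad)
24*quads≡orderedSum {n} S = trans (cong (24 *_) (quads≡∑choose S))
  (!*∑-choose≡orderedSum 4 (filter⁺ _ (deck-unique n)) isQuad-symmetric)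

module _ {n : ℕ} (S : CardSet n) where

  private
    L : List (Card n)
    L = elems S
    e : Card n → Card n → Card n → Card n
    e a b c = a ⊕ (b ⊕ c)

    ∑-remove¹ : ∀ a (f : Card n → ℕ) → ∑ (remove a L) f ≡ ∑[ x ∈ deck n ] (χ S x * ([ x ≢ a ] * f x))
    ∑-remove¹ a f = trans (∑-remove a L f) (∑-elems S _)

    ∑-remove² : ∀ a b (f : Card n → ℕ) →
                ∑ (remove b (remove a L)) f ≡ ∑[ x ∈ deck n ] (χ S x * ([ x ≢ a ] * ([ x ≢ b ] * f x)))
    ∑-remove² a b f = trans (∑-remove b (remove a L) f) (∑-remove¹ a _)

    ∑-remove³ : ∀ a b c (f : Card n → ℕ) →
                ∑ (remove c (remove b (remove a L))) f
                ≡ ∑[ x ∈ deck n ] (χ S x * ([ x ≢ a ] * ([ x ≢ b ] * ([ x ≢ c ] * f x))))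
    ∑-remove³ a b c f = trans (∑-remove c (remove b (remove a L)) f) (∑-remove² a b _)

    quad-completion : ∀ a b c → ∑[ d ∈ remove c (remove b (remove a L)) ] 𝟙 (isQuad (a ∷ b ∷ c ∷ d ∷ []))
                                ≡ χ S (e a b c) * ([ c ≢ b ] * ([ c ≢ a ] * [ b ≢ a ]))
    quad-completion a b c = begin
      ∑[ d ∈ remove c (remove b (remove a L)) ] 𝟙 (isQuad (a ∷ b ∷ c ∷ d ∷ []))
        ≡⟨ ∑-remove³ a b c _ ⟩
      ∑[ d ∈ deck n ] (χ S d * ([ d ≢ a ] * ([ d ≢ b ] * ([ d ≢ c ] * 𝟙 (isQuad (a ∷ b ∷ c ∷ d ∷ []))))))
        ≡⟨ ∑-cong (deck n) (λ d → trans (cong (λ t → χ S d * ([ d ≢ a ] * ([ d ≢ b ] * ([ d ≢ c ] * 𝟙 t))))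
                                                (isQuad≡does a b c d))
                                          (rearrange (χ S d) [ d ≢ a ] [ d ≢ b ] [ d ≢ c ] [ d ≡ e a b c ])) ⟩
      ∑[ d ∈ deck n ] ([ d ≡ e a b c ] * (χ S d * ([ d ≢ a ] * ([ d ≢ b ] * [ d ≢ c ]))))
        ≡⟨ ∑-deck-δ (e a b c) _ ⟩
      χ S (e a b c) * ([ e a b c ≢ a ] * ([ e a b c ≢ b ] * [ e a b c ≢ c ]))
        ≡⟨ cong (χ S (e a b c) *_) (fourth≢ a b c) ⟩
      χ S (e a b c) * ([ c ≢ b ] * ([ c ≢ a ] * [ b ≢ a ]))
        ∎
      where
      open ≡-Reasoning
      rearrange : ∀ x p q r t → x * (p * (q * (r * t))) ≡ t * (x * (p * (q * r)))
      rearrange = solve-∀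

  orderedSum≡distinct : orderedSum 4 (elems S) (𝟙 ∘ isQuad) ≡ distinctZeroSumQuadruples S
  orderedSum≡distinct = begin
    ∑[ a ∈ L ] ∑[ b ∈ remove a L ] ∑[ c ∈ remove b (remove a L) ] ∑[ d ∈ remove c (remove b (remove a L)) ]
      𝟙 (isQuad (a ∷ b ∷ c ∷ d ∷ []))
      ≡⟨ ∑-cong L (λ a → ∑-cong (remove a L) (λ b → ∑-cong (remove b (remove a L)) (quad-completion a b))) ⟩
    ∑[ a ∈ L ] ∑[ b ∈ remove a L ] ∑[ c ∈ remove b (remove a L) ] g a b c
      ≡⟨ ∑-elems S _ ⟩
    ∑[ a ∈ deck n ] (χ S a * ∑[ b ∈ remove a L ] ∑[ c ∈ remove b (remove a L) ] g a b c)
      ≡⟨ ∑-cong (deck n) (λ a → cong (χ S a *_) (trans (∑-remove¹ a _) (∑-cong (deck n) (λ b →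
           cong (λ t → χ S b * ([ b ≢ a ] * t)) (∑-remove² a b (g a b)))))) ⟩
    ∑[ a ∈ deck n ] (χ S a * ∑[ b ∈ deck n ] (χ S b * ([ b ≢ a ] * ∑[ c ∈ deck n ] h a b c)))
      ≡⟨ ∑-cong (deck n) (λ a → trans (cong (χ S a *_) (∑-cong (deck n) (λ b →
                                        trans (sym (*-assoc (χ S b) [ b ≢ a ] _)) (pull (χ S b * [ b ≢ a ]) (h a b)))))
                                      (trans (pull (χ S a) _) (∑-cong (deck n) (λ b → pull (χ S a) _)))) ⟩
    ∑³ (λ a b c → χ S a * (χ S b * [ b ≢ a ] * h a b c))
      ≡⟨ ∑³-cong collect ⟩
    distinctZeroSumQuadruples S
      ∎
    where
    open ≡-Reasoning
    g h : Card n → Card n → Card n → ℕ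
    g a b c = χ S (e a b c) * ([ c ≢ b ] * ([ c ≢ a ] * [ b ≢ a ]))
    h a b c = χ S c * ([ c ≢ a ] * ([ c ≢ b ] * g a b c))
    pull : ∀ m (f : Card n → ℕ) → m * ∑ (deck n) f ≡ ∑[ x ∈ deck n ] (m * f x)
    pull m f = sym (∑-*ˡ (deck n) m f)
    collect : ∀ a b c → χ S a * (χ S b * [ b ≢ a ] * h a b c)
                        ≡ [ b ≢ a ] * ([ c ≢ a ] * [ c ≢ b ]) * quadTerm (χ S) (χ S) (χ S) (χ S) a b c
    collect a b c =
      trans (rearrange (χ S a) (χ S b) (χ S c) (χ S (e a b c)) [ b ≢ a ] [ c ≢ a ] [ c ≢ b ])
            (cong (_* quadTerm (χ S) (χ S) (χ S) (χ S) a b c)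
                  (cong₂ _*_ (idem b a) (cong₂ _*_ (idem c a) (idem c b))))
      where
      rearrange : ∀ x y z u p q r → x * (y * p * (z * (q * (r * (u * (r * (q * p)))))))
                                    ≡ p * p * (q * q * (r * r)) * (x * (y * (z * u)))
      rearrange = solve-∀
      idem : ∀ x y → [ x ≢ y ] * [ x ≢ y ] ≡ [ x ≢ y ]
      idem x y = 𝟙-idem (not (does (x ≟ y)))

distinct+coincident : ∀ {n} (a b c : Card n) →
  [ b ≢ a ] * ([ c ≢ a ] * [ c ≢ b ]) + [ b ≡ a ] + [ c ≡ a ] + [ c ≡ b ] ≡ 1 + 2 * ([ b ≡ a ] * [ c ≡ a ])
distinct+coincident a b c with b ≟ a | c ≟ a | c ≟ b
... | yes _   | yes _   | yes _   = refl
... | yes b≡a | yes c≡a | no c≢b  = contradiction (trans c≡a (sym b≡a)) c≢b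
... | yes b≡a | no c≢a  | yes c≡b = contradiction (trans c≡b b≡a) c≢a
... | yes _   | no _    | no _    = refl
... | no b≢a  | yes c≡a | yes c≡b = contradiction (trans (sym c≡b) c≡a) b≢a
... | no _    | yes _   | no _    = refl
... | no _    | no _    | yes _   = refl
... | no _    | no _    | no _    = refl

module _ {n : ℕ} (S : CardSet n) where

  private
    k : ℕ
    k = ∑ (deck n) (χ S)
    w : Card n → Card n → Card n → ℕ
    w = quadTerm (χ S) (χ S) (χ S) (χ S)

    w-aac : ∀ a c → w a a c ≡ χ S a * χ S c
    w-aac a c = trans (cong (λ d → χ S a * (χ S a * (χ S c * χ S d))) (⊕-cancelˡ a c)) (idem (S a) (S c))
      where
      idem : ∀ x y → 𝟙 x * (𝟙 x * (𝟙 y * 𝟙 y)) ≡ 𝟙 x * 𝟙 y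
      idem false y     = refl
      idem true  false = refl
      idem true  true  = refl

    w-aba : ∀ a b → w a b a ≡ χ S a * χ S b
    w-aba a b = trans (cong (λ d → χ S a * (χ S b * (χ S a * χ S d)))
                            (trans (⊕.x∙yz≈x∙zy a b a) (⊕-cancelˡ a b)))
                      (idem (S a) (S b))
      where
      idem : ∀ x y → 𝟙 x * (𝟙 y * (𝟙 x * 𝟙 y)) ≡ 𝟙 x * 𝟙 y
      idem false y     = refl
      idem true  false = refl
      idem true  true  = refl

    w-abb : ∀ a b → w a b b ≡ χ S a * χ S b
    w-abb a b = trans (cong (λ d → χ S a * (χ S b * (χ S b * χ S d)))
                            (trans (⊕.x∙yz≈z∙yx a b b) (⊕-cancelˡ b a)))
                      (idem (S a) (S b))
      where
      idem : ∀ x y → 𝟙 x * (𝟙 y * (𝟙 y * 𝟙 x)) ≡ 𝟙 x * 𝟙 y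
      idem false y     = refl
      idem true  false = refl
      idem true  true  = refl

    w-aaa : ∀ a → w a a a ≡ χ S a
    w-aaa a = trans (cong (λ d → χ S a * (χ S a * (χ S a * χ S d))) (⊕-cancelˡ a a)) (idem (S a))
      where
      idem : ∀ x → 𝟙 x * (𝟙 x * (𝟙 x * 𝟙 x)) ≡ 𝟙 x
      idem false = refl
      idem true  = refl

    ∑³-[b≡a] : ∑³ (λ a b c → [ b ≡ a ] * w a b c) ≡ k * k
    ∑³-[b≡a] = begin
      ∑³ (λ a b c → [ b ≡ a ] * w a b c)
        ≡⟨ ∑-cong (deck n) (λ a → ∑-cong (deck n) (λ b → ∑-*ˡ (deck n) [ b ≡ a ] (w a b))) ⟩
      ∑[ a ∈ deck n ] ∑[ b ∈ deck n ] ([ b ≡ a ] * ∑ (deck n) (w a b))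
        ≡⟨ ∑-cong (deck n) (λ a → ∑-deck-δ a (λ b → ∑ (deck n) (w a b))) ⟩
      ∑[ a ∈ deck n ] ∑ (deck n) (w a a)
        ≡⟨ ∑-cong (deck n) (λ a → ∑-cong (deck n) (w-aac a)) ⟩
      ∑[ a ∈ deck n ] ∑[ c ∈ deck n ] (χ S a * χ S c)
        ≡⟨ ∑-product (deck n) (deck n) (χ S) (χ S) ⟩
      k * k
        ∎
      where open ≡-Reasoning

    ∑³-[c≡a] : ∑³ (λ a b c → [ c ≡ a ] * w a b c) ≡ k * k
    ∑³-[c≡a] = trans (∑-cong (deck n) (λ a → ∑-cong (deck n) (λ b → trans (∑-deck-δ a (w a b)) (w-aba a b))))
                     (∑-product (deck n) (deck n) (χ S) (χ S))

    ∑³-[c≡b] : ∑³ (λ a b c → [ c ≡ b ] * w a b c) ≡ k * k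
    ∑³-[c≡b] = trans (∑-cong (deck n) (λ a → ∑-cong (deck n) (λ b → trans (∑-deck-δ b (w a b)) (w-abb a b))))
                     (∑-product (deck n) (deck n) (χ S) (χ S))

    ∑³-[b≡a≡c] : ∑³ (λ a b c → [ b ≡ a ] * ([ c ≡ a ] * w a b c)) ≡ k
    ∑³-[b≡a≡c] = begin
      ∑³ (λ a b c → [ b ≡ a ] * ([ c ≡ a ] * w a b c))
        ≡⟨ ∑-cong (deck n) (λ a → ∑-cong (deck n) (λ b →
             ∑-*ˡ (deck n) [ b ≡ a ] (λ c → [ c ≡ a ] * w a b c))) ⟩
      ∑[ a ∈ deck n ] ∑[ b ∈ deck n ] ([ b ≡ a ] * ∑[ c ∈ deck n ] ([ c ≡ a ] * w a b c))
        ≡⟨ ∑-cong (deck n) (λ a → ∑-cong (deck n) (λ b → cong ([ b ≡ a ] *_) (∑-deck-δ a (w a b)))) ⟩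
      ∑[ a ∈ deck n ] ∑[ b ∈ deck n ] ([ b ≡ a ] * w a b a)
        ≡⟨ ∑-cong (deck n) (λ a → trans (∑-deck-δ a (λ b → w a b a)) (w-aaa a)) ⟩
      k
        ∎
      where open ≡-Reasoning

  distinct+3k²≡zeroSum+2k : let k = ∑ (deck n) (χ S) in
                            distinctZeroSumQuadruples S + 3 * (k * k) ≡ zeroSumQuadruples S + 2 * k
  distinct+3k²≡zeroSum+2k = begin
    ∑³ d + 3 * (k * k)
      ≡⟨ three (∑³ d) (k * k) ⟩
    ∑³ d + k * k + k * k + k * k
      ≡⟨ cong (∑³ d + k * k + k * k +_) ∑³-[c≡b] ⟨
    ∑³ d + k * k + k * k + ∑³ e₃
      ≡⟨ cong₂ (λ x y → ∑³ d + x + y + ∑³ e₃) ∑³-[b≡a] ∑³-[c≡a] ⟨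
    ∑³ d + ∑³ e₁ + ∑³ e₂ + ∑³ e₃
      ≡⟨ ∑³-+⁴ ⟨
    ∑³ (λ a b c → d a b c + e₁ a b c + e₂ a b c + e₃ a b c)
      ≡⟨ ∑³-cong pointwise ⟩
    ∑³ (λ a b c → w a b c + 2 * e₁₂ a b c)
      ≡⟨ ∑³-+ w (λ a b c → 2 * e₁₂ a b c) ⟩
    ∑³ w + ∑³ (λ a b c → 2 * e₁₂ a b c)
      ≡⟨ cong (∑³ w +_) (trans (∑³-*ˡ 2 e₁₂) (cong (2 *_) ∑³-[b≡a≡c])) ⟩
    zeroSumQuadruples S + 2 * k
      ∎
    where
    open ≡-Reasoning
    d e₁ e₂ e₃ e₁₂ : Card n → Card n → Card n → ℕ
    d a b c   = [ b ≢ a ] * ([ c ≢ a ] * [ c ≢ b ]) * w a b c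
    e₁ a b c  = [ b ≡ a ] * w a b c
    e₂ a b c  = [ c ≡ a ] * w a b c
    e₃ a b c  = [ c ≡ b ] * w a b c
    e₁₂ a b c = [ b ≡ a ] * ([ c ≡ a ] * w a b c)
    three : ∀ x y → x + 3 * y ≡ x + y + y + y
    three = solve-∀
    ∑³-+⁴ : ∑³ (λ a b c → d a b c + e₁ a b c + e₂ a b c + e₃ a b c)
            ≡ ∑³ d + ∑³ e₁ + ∑³ e₂ + ∑³ e₃
    ∑³-+⁴ = trans (∑³-+ (λ a b c → d a b c + e₁ a b c + e₂ a b c) e₃)
                  (cong (_+ ∑³ e₃) (trans (∑³-+ (λ a b c → d a b c + e₁ a b c) e₂)
                                          (cong (_+ ∑³ e₂) (∑³-+ d e₁))))
    distrib : ∀ x p q r y → x * y + p * y + q * y + r * y ≡ (x + p + q + r) * y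
    distrib = solve-∀
    distrib′ : ∀ p q y → (1 + 2 * (p * q)) * y ≡ y + 2 * (p * (q * y))
    distrib′ = solve-∀
    pointwise : ∀ a b c → d a b c + e₁ a b c + e₂ a b c + e₃ a b c ≡ w a b c + 2 * e₁₂ a b c
    pointwise a b c = trans (distrib ([ b ≢ a ] * ([ c ≢ a ] * [ c ≢ b ])) [ b ≡ a ] [ c ≡ a ] [ c ≡ b ] (w a b c))
                     (trans (cong (_* w a b c) (distinct+coincident a b c)) (distrib′ [ b ≡ a ] [ c ≡ a ] (w a b c)))

24*quads+3k²≡zeroSum+2k : ∀ {n} (S : CardSet n) →
  24 * quads S + 3 * (card S * card S) ≡ zeroSumQuadruples S + 2 * card S
24*quads+3k²≡zeroSum+2k {n} S = begin
  24 * quads S + 3 * (card S * card S)          ≡⟨ cong₂ (λ q k → q + 3 * (k * k)) 24*quads≡distinct (card≡∑χ S) ⟩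
  distinctZeroSumQuadruples S + 3 * (k * k)     ≡⟨ distinct+3k²≡zeroSum+2k S ⟩
  zeroSumQuadruples S + 2 * k                   ≡⟨ cong (λ k → zeroSumQuadruples S + 2 * k) (card≡∑χ S) ⟨
  zeroSumQuadruples S + 2 * card S              ∎
  where
  open ≡-Reasoning
  k : ℕ
  k = ∑ (deck n) (χ S)
  24*quads≡distinct : 24 * quads S ≡ distinctZeroSumQuadruples S
  24*quads≡distinct = trans (24*quads≡orderedSum S) (orderedSum≡distinct S)

module _ {n : ℕ} (S T : CardSet n) (|S|≡|T| : card S ≡ card T) where

  zeroSum≤⇒quads≤ : zeroSumQuadruples S ≤ zeroSumQuadruples T → quads S ≤ quads T
  zeroSum≤⇒quads≤ F≤ = *-cancelˡ-≤ 24 (+-cancelʳ-≤ (3 * (card S * card S)) _ _ (begin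
    24 * quads S + 3 * (card S * card S)   ≡⟨ 24*quads+3k²≡zeroSum+2k S ⟩
    zeroSumQuadruples S + 2 * card S       ≤⟨ +-monoˡ-≤ (2 * card S) F≤ ⟩
    zeroSumQuadruples T + 2 * card S       ≡⟨ cong (λ k → zeroSumQuadruples T + 2 * k) |S|≡|T| ⟩
    zeroSumQuadruples T + 2 * card T       ≡⟨ 24*quads+3k²≡zeroSum+2k T ⟨
    24 * quads T + 3 * (card T * card T)   ≡⟨ cong (λ k → 24 * quads T + 3 * (k * k)) |S|≡|T| ⟨
    24 * quads T + 3 * (card S * card S)   ∎))
    where open ≤-Reasoning

  quads≤⇒zeroSum≤ : quads S ≤ quads T → zeroSumQuadruples S ≤ zeroSumQuadruples T
  quads≤⇒zeroSum≤ q≤ = +-cancelʳ-≤ (2 * card S) _ _ (begin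
    zeroSumQuadruples S + 2 * card S       ≡⟨ 24*quads+3k²≡zeroSum+2k S ⟨
    24 * quads S + 3 * (card S * card S)   ≤⟨ +-monoˡ-≤ _ (*-monoʳ-≤ 24 q≤) ⟩
    24 * quads T + 3 * (card S * card S)   ≡⟨ cong (λ k → 24 * quads T + 3 * (k * k)) |S|≡|T| ⟩
    24 * quads T + 3 * (card T * card T)   ≡⟨ 24*quads+3k²≡zeroSum+2k T ⟩
    zeroSumQuadruples T + 2 * card T       ≡⟨ cong (λ k → zeroSumQuadruples T + 2 * k) |S|≡|T| ⟨
    zeroSumQuadruples T + 2 * card S       ∎)
    where open ≤-Reasoning

-- Complements

module _ {n : ℕ} (S : CardSet n) where

  private
    s u : Card n → ℕ
    s = χ S
    u = χ (complement S)
    k m : ℕ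
    k = card S
    m = card (complement S)

    split : ∀ f₁ f₂ f₃ →
            quadSum f₁ f₂ f₃ s + quadSum f₁ f₂ f₃ u ≡ ∑ (deck n) f₁ * (∑ (deck n) f₂ * ∑ (deck n) f₃)
    split f₁ f₂ f₃ =
      trans (sym (quadSum-+₄ f₁ f₂ f₃ {s} {u} (λ x → sym (χ+χᶜ≡1 S x)))) (quadSum-1₄ f₁ f₂ f₃)

  -- Splitting the last slot along s + u = 1 in quadSum u u u 1, quadSum s u u 1, quadSum s s u 1 and
  -- quadSum s s s 1, and moving slots by symmetry, the mixed terms telescope away.
  zeroSumQuadruples-complement : let k = card S; m = card (complement S) in
    zeroSumQuadruples (complement S) + (k * (m * m) + k * (k * k)) ≡ zeroSumQuadruples S + (m * (m * m) + k * (k * m))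
  zeroSumQuadruples-complement = begin
    quadSum u u u u + (k * (m * m) + k * (k * k))
      ≡⟨ cong₂ (λ x y → quadSum u u u u + (x + y)) (sym eq₂) (sym eq₄) ⟩
    quadSum u u u u + (quadSum s s u u + quadSum s u u u + (quadSum s s s s + quadSum s s s u))
      ≡⟨ regroup (quadSum u u u u) (quadSum s s s s) (quadSum s u u u) (quadSum s s u u) (quadSum s s s u) ⟩
    quadSum s s s s + (quadSum s u u u + quadSum u u u u + (quadSum s s s u + quadSum s s u u))
      ≡⟨ cong₂ (λ x y → quadSum s s s s + (x + y)) eq₁ eq₃ ⟩
    quadSum s s s s + (m * (m * m) + k * (k * m))
      ∎
    where
    open ≡-Reasoning
    k≡ : ∑ (deck n) s ≡ k
    k≡ = sym (card≡∑χ S)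
    m≡ : ∑ (deck n) u ≡ m
    m≡ = sym (card≡∑χ (complement S))
    regroup : ∀ fu fs a b c → fu + (b + a + (fs + c)) ≡ fs + (a + fu + (c + b))
    regroup = solve-∀
    eq₁ : quadSum s u u u + quadSum u u u u ≡ m * (m * m)
    eq₁ = begin
      quadSum s u u u + quadSum u u u u  ≡⟨ cong (_+ quadSum u u u u) (quadSum-swap₁₄ u u u s) ⟨
      quadSum u u u s + quadSum u u u u  ≡⟨ split u u u ⟩
      ∑ (deck n) u * (∑ (deck n) u * ∑ (deck n) u)  ≡⟨ cong₂ (λ x y → x * (y * y)) m≡ m≡ ⟩
      m * (m * m)                        ∎
    eq₂ : quadSum s s u u + quadSum s u u u ≡ k * (m * m)
    eq₂ = begin
      quadSum s s u u + quadSum s u u u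
        ≡⟨ cong (_+ quadSum s u u u) (trans (quadSum-swap₃₄ s u u s) (quadSum-swap₂₃ s u s u)) ⟨
      quadSum s u u s + quadSum s u u u  ≡⟨ split s u u ⟩
      ∑ (deck n) s * (∑ (deck n) u * ∑ (deck n) u)  ≡⟨ cong₂ (λ x y → x * (y * y)) k≡ m≡ ⟩
      k * (m * m)                        ∎
    eq₃ : quadSum s s s u + quadSum s s u u ≡ k * (k * m)
    eq₃ = begin
      quadSum s s s u + quadSum s s u u  ≡⟨ cong (_+ quadSum s s u u) (quadSum-swap₃₄ s s u s) ⟨
      quadSum s s u s + quadSum s s u u  ≡⟨ split s s u ⟩
      ∑ (deck n) s * (∑ (deck n) s * ∑ (deck n) u)  ≡⟨ cong₂ (λ x y → x * (x * y)) k≡ m≡ ⟩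
      k * (k * m)                        ∎
    eq₄ : quadSum s s s s + quadSum s s s u ≡ k * (k * k)
    eq₄ = trans (split s s s) (cong (λ x → x * (x * x)) k≡)

zeroSumQuadruples-complement-mono : ∀ {n} (S T : CardSet n) → card S ≡ card T →
  zeroSumQuadruples S ≤ zeroSumQuadruples T → zeroSumQuadruples (complement S) ≤ zeroSumQuadruples (complement T)
zeroSumQuadruples-complement-mono S T |S|≡|T| F≤ = +-cancelʳ-≤ (X k m) _ _ (begin
  zeroSumQuadruples (complement S) + X k m   ≡⟨ zeroSumQuadruples-complement S ⟩
  zeroSumQuadruples S + Y k m                ≤⟨ +-monoˡ-≤ (Y k m) F≤ ⟩
  zeroSumQuadruples T + Y k m                ≡⟨ cong₂ (λ k m → zeroSumQuadruples T + Y k m) |S|≡|T| |Sᶜ|≡|Tᶜ| ⟩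
  zeroSumQuadruples T + Y k′ m′              ≡⟨ zeroSumQuadruples-complement T ⟨
  zeroSumQuadruples (complement T) + X k′ m′
    ≡⟨ cong₂ (λ k m → zeroSumQuadruples (complement T) + X k m) |S|≡|T| |Sᶜ|≡|Tᶜ| ⟨
  zeroSumQuadruples (complement T) + X k m   ∎)
  where
  open ≤-Reasoning
  k m k′ m′ : ℕ
  k = card S
  m = card (complement S)
  k′ = card T
  m′ = card (complement T)
  |Sᶜ|≡|Tᶜ| : m ≡ m′
  |Sᶜ|≡|Tᶜ| = card-complement-cong S T |S|≡|T|
  X Y : ℕ → ℕ → ℕ
  X k m = k * (m * m) + k * (k * k)
  Y k m = m * (m * m) + k * (k * m)

mainTheorem5 : (n : ℕ) (S : CardSet n) → Packed S → Packed (complement S)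
mainTheorem5 n S S-packed T |T|≡|Sᶜ| = zeroSum≤⇒quads≤ T (complement S) |T|≡|Sᶜ| (begin
  zeroSumQuadruples T
    ≡⟨ zeroSumQuadruples-cong (λ x → sym (not-involutive (T x))) ⟩
  zeroSumQuadruples (complement (complement T))
    ≤⟨ zeroSumQuadruples-complement-mono (complement T) S |Tᶜ|≡|S| Tᶜ-below-S ⟩
  zeroSumQuadruples (complement S)
    ∎)
  where
  open ≤-Reasoning
  |Tᶜ|≡|S| : card (complement T) ≡ card S
  |Tᶜ|≡|S| = card-complement-flip T S |T|≡|Sᶜ|
  Tᶜ-below-S : zeroSumQuadruples (complement T) ≤ zeroSumQuadruples S
  Tᶜ-below-S = quads≤⇒zeroSum≤ (complement T) S |Tᶜ|≡|S| (S-packed (complement T) |Tᶜ|≡|S|)
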